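{- For every $I\in\mathcal I$, there is exactly one $\vartriangleleft$-minimal set in $\mathcal M(I)$.
   Context: Let $a_1,\dots,a_n$ be distinct integers between $1$ and $n$, and set $a_0=0$, so $A=(a_i)_{i=0,1,\dots,n}$. A set $I\subseteq\{0\}\cup[n]$ is feasible if $a_i<a_j$ for all $i,j\in I$ with $i<j$; $\mathcal I$ denotes the family of maximum-cardinality feasible sets. Patience sorting: start with empty piles $P_0,P_1,\dots,P_n$; for $i=0,1,\dots,n$ in this order, put $a_i$ on the top of the leftmost (smallest-index) pile $P_j$ that is empty or whose current top element is greater than $a_i$. Let $P_0,\dots,P_k$ be the resulting nonempty piles; "$a_u$ is placed below $a_v$" means $a_u$ was put on that pile before $a_v$. For $I,J\in\mathcal I$, write $I\vartriangleleft J$ if $I\setminus J=\{u\}$, $J\setminus I=\{v\}$, and $a_u$ is placed strictly below $a_v$ on the same pile $P_i$ for some $1\le i\le k$. For $I\in\mathcal I$, $\mathcal M(I)\subseteq\mathcal I$ is the smallest family containing $I$ such that $J\in\mathcal M(I)$ and $J'\vartriangleleft J$ imply $J'\in\mathcal M(I)$ (the lower set of $I$ in the transitive closure of $\vartriangleleft$). A set $J\in\mathcal I$ is $\vartriangleleft$-minimal if there is no $J'\in\mathcal I$ with $J'\vartriangleleft J$. -}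

module Defs where

open import Data.Nat using (ℕ; zero; suc; _<_; _≤_; _<ᵇ_)
open import Data.Fin using (Fin; toℕ) renaming (zero to fzero; suc to fsuc)
open import Data.Fin.Subset using (Subset; _∈_; _∉_; ∣_∣)
open import Data.List using (List; []; _∷_; _++_; foldl; drop; allFin)
open import Data.Bool using (if_then_else_)
open import Data.Product using (Σ; ∃; _×_)
open import Relation.Nullary using (¬_)
open import Relation.Binary.PropositionalEquality using (_≡_)
open import Relation.Binary.Construct.Closure.ReflexiveTransitive using (Star)

-- The sequence a_1..a_n is given by a : Fin n → Fin n (a_{i+1} = 1 + toℕ (a i)),
-- distinctness = injectivity.  Indices 0..n are Fin (suc n); A 0 = 0.
seqA : {n : ℕ} → (Fin n → Fin n) → Fin (suc n) → ℕ
seqA a fzero = 0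
seqA a (fsuc i) = suc (toℕ (a i))

module _ {n : ℕ} (a : Fin n → Fin n) where

  Idx : Set
  Idx = Fin (suc n)

  A : Idx → ℕ
  A = seqA a

  Feasible : Subset (suc n) → Set
  Feasible I = ∀ i j → i ∈ I → j ∈ I → toℕ i < toℕ j → A i < A j

  -- maximum-cardinality feasible sets (the family 𝓘)
  MaxFeasible : Subset (suc n) → Set
  MaxFeasible I = Feasible I × (∀ J → Feasible J → ∣ J ∣ ≤ ∣ I ∣)

  -- Patience sorting on indices.  A pile is a list with its TOP element first;
  -- the list of piles is ordered P_0, P_1, ... .
  Piles : Set
  Piles = List (List Idx)

  place : Idx → Piles → Piles
  place x [] = (x ∷ []) ∷ []
  place x ([] ∷ ps) = (x ∷ []) ∷ ps
  place x ((t ∷ p) ∷ ps) =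
    if A x <ᵇ A t then (x ∷ t ∷ p) ∷ ps else (t ∷ p) ∷ place x ps

  piles : Piles
  piles = foldl (λ ps x → place x ps) [] (allFin (suc n))

  PlacedBelow : Idx → Idx → Set
  PlacedBelow u v =
    Σ ℕ λ i → 1 ≤ i × Σ (List Idx) λ p → Σ Piles λ rest →
      drop i piles ≡ p ∷ rest ×
      Σ (List Idx) λ xs → Σ (List Idx) λ ys → Σ (List Idx) λ zs →
        p ≡ xs ++ (v ∷ ys ++ (u ∷ zs))

  _◁_ : Subset (suc n) → Subset (suc n) → Set
  I ◁ J = MaxFeasible I × MaxFeasible J ×
    Σ Idx λ u → Σ Idx λ v →
      (u ∈ I × u ∉ J × (∀ w → w ∈ I → w ∉ J → w ≡ u)) ×
      (v ∈ J × v ∉ I × (∀ w → w ∈ J → w ∉ I → w ≡ v)) ×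
      PlacedBelow u v

  -- J ∈ 𝓜(I): J reachable from I by going down along ◁ (reflexive-transitive)
  InM : Subset (suc n) → Subset (suc n) → Set
  InM I J = Star _◁_ J I

  ◁-Minimal : Subset (suc n) → Set
  ◁-Minimal J = MaxFeasible J × ¬ (∃ λ J′ → MaxFeasible J′ × J′ ◁ J)

-- Newman's lemma for the reduction J ⟶ J′ :⇔ J′ ◁ J. Read from the bottom, every pile has
-- increasing indices and decreasing values, so J′ ◁ J swaps an element v of J for an earlier
-- index u; hence Σ_{x ∈ J} (1 + x) decreases and ⟶ terminates. For local confluence let
-- J₁, J₂ ◁ J swap vᵢ for uᵢ. If v₁ = v₂, disjointness of the piles puts u₁ and u₂ on the pile
-- of v₁, so one of J₁, J₂ is ◁ the other. If v₁ ≠ v₂, then u₁ ≠ u₂ (else u₁ and v₂ form an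
-- inversion inside J₁), and performing both swaps, (J₁ - v₂) ∪ (J₂ - v₁), gives a common
-- lower neighbour: its only new pair {u₁, u₂} is increasing, because for v₁ < v₂ the values
-- force u₂ to the right of v₁. Everything is decidable, so termination yields a normal form.

module Submission where

open import Defs
open import Data.Nat using (ℕ; zero; suc; _+_; _<_; _≤_; _<ᵇ_; _<?_; _≤?_; z≤n; s≤s; s<s)
open import Data.Nat.Induction using (<-wellFounded)
open import Data.Nat.Properties
  using (<ᵇ⇒<; <-trans; <-asym; <-irrefl; ≤-trans; ≤-reflexive; <-≤-trans; ≤-<-trans; ≮⇒≥;
         n<1+n; m≤n⇒m≤1+n; +-monoˡ-<; module ≤-Reasoning)
open import Data.Nat.Tactic.RingSolver using (solve-∀)
open import Data.Bool using (true; false)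
open import Data.Bool.Properties using (T-≡)
open import Data.Fin using (Fin; toℕ; _≟_) renaming (zero to fzero; suc to fsuc)
open import Data.Fin.Properties using (all?; any?) renaming (<-cmp to <-cmp-Fin)
open import Data.Fin.Subset using (Subset; inside; outside; _∈_; _∉_; _⊆_; _∪_; _∩_; _-_; ⁅_⁆; ∣_∣)
open import Data.Fin.Subset.Properties
  using (_∈?_; anySubset?; ⊆-antisym; p─q⊆p; x∈p∧x≢y⇒x∈p-y; ∪-identityʳ; ∪-comm; ∩-comm;
         x∈p∪q⁺; x∈p∪q⁻; x∈p∩q⁺; x∈p∩q⁻; x∈⁅x⁆; x∈⁅y⁆⇒x≡y)
open import Data.Vec using ([]; _∷_; here; there)
open import Data.List using (List; []; _∷_; _++_; drop; foldl; allFin)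
open import Data.List.Properties using (∷-injective; ∷-injectiveˡ)
open import Data.List.Membership.Propositional using () renaming (_∈_ to _∈ₗ_; _∉_ to _∉ₗ_)
open import Data.List.Membership.Propositional.Properties using (∈-∃++; ∈-++⁺ʳ)
import Data.List.Membership.DecPropositional as DecMembership
open import Data.List.Relation.Unary.Any using (here; there)
open import Data.List.Relation.Unary.All as All using (All; []; _∷_)
open import Data.List.Relation.Unary.All.Properties using (tabulate⁺)
open import Data.List.Relation.Unary.AllPairs using (AllPairs; []; _∷_)
open import Data.List.Relation.Unary.AllPairs.Properties using (tabulate⁺-<)
open import Data.List.Relation.Binary.Disjoint.Propositional using (Disjoint)
open import Data.List.Relation.Binary.Disjoint.Propositional.Properties
  using () renaming (sym to Disjoint-sym)
open import Data.Product using (Σ; ∃; _×_; _,_; proj₁; proj₂; swap)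
open import Data.Sum using (_⊎_; inj₁; inj₂)
open import Data.Empty using (⊥-elim)
open import Function using (_∘_; flip; id)
open import Function.Bundles using (Equivalence; _⇔_; mk⇔)
open import Function.Definitions using (Injective)
open import Induction.WellFounded using (Acc; acc; module Subrelation)
open import Relation.Nullary using (¬_; Dec; yes; no)
open import Relation.Nullary.Decidable using (map′; ¬?; _×-dec_; _⊎-dec_; _→-dec_; decidable-stable)
open import Relation.Unary using (Decidable)
open import Relation.Binary.Core using (Rel)
open import Relation.Binary.Definitions using (DecidableEquality; tri<; tri≈; tri>)
open import Relation.Binary.PropositionalEquality
  using (_≡_; _≢_; refl; sym; trans; cong; cong₂; subst; subst₂; module ≡-Reasoning)
open import Relation.Binary.Construct.On using () renaming (wellFounded to On-wellFounded)
open import Relation.Binary.Construct.Closure.ReflexiveTransitive using (Star; ε; _◅_; reverse)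
open import Relation.Binary.Construct.Closure.Transitive using (Plus; [_]; _∼⁺⟨_⟩_)
open import Relation.Binary.Construct.Closure.Equivalence.Properties using (a—↠b&a—↠c⇒b↔c)
open import Relation.Binary.Rewriting
  using (IsNormalForm; HasNormalForm; WeaklyNormalizing; StronglyNormalizing; WeaklyConfluent;
         sn&wcr⇒cr; conf⇒unf)

-- Normal forms of terminating rewriting systems

module _ {a ℓ} {X : Set a} {_⟶_ : Rel X ℓ} where

  measure⇒sn : (f : X → ℕ) → (∀ {x y} → x ⟶ y → f y < f x) → StronglyNormalizing (Plus _⟶_)
  measure⇒sn f decreasing = Subrelation.wellFounded plus-decreasing (On-wellFounded f <-wellFounded)
    where
    plus-decreasing : ∀ {x y} → Plus _⟶_ x y → f y < f x
    plus-decreasing [ x⟶y ] = decreasing x⟶y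
    plus-decreasing (_ ∼⁺⟨ x⟶⁺z ⟩ z⟶⁺y) = <-trans (plus-decreasing z⟶⁺y) (plus-decreasing x⟶⁺z)

  sn&dec⇒wn : StronglyNormalizing (Plus _⟶_) → (∀ x → Dec (∃ (x ⟶_))) → WeaklyNormalizing _⟶_
  sn&dec⇒wn sn step? x = normalise (sn x)
    where
    normalise : ∀ {x} → Acc (flip (Plus _⟶_)) x → HasNormalForm _⟶_ x
    normalise {x} (acc rec) with step? x
    ... | no irreducible = x , irreducible , ε
    ... | yes (y , x⟶y) with normalise (rec [ x⟶y ])
    ...   | z , z-nf , y↠z = z , z-nf , x⟶y ◅ y↠z

-- Exchanging one element of a finite set

infix 4 _∖_≐_

_∖_≐_ : ∀ {m} → Subset m → Subset m → Fin m → Set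
S ∖ T ≐ u = u ∈ S × u ∉ T × (∀ w → w ∈ S → w ∉ T → w ≡ u)

-- weight S = Σ_{x ∈ S} (1 + toℕ x)
weight : ∀ {m} → Subset m → ℕ
weight [] = 0
weight (s ∷ S) = ∣ s ∷ S ∣ + weight S

∣∪⁅⁆∣ : ∀ {m} {x : Fin m} (C : Subset m) → x ∉ C → ∣ C ∪ ⁅ x ⁆ ∣ ≡ suc ∣ C ∣
∣∪⁅⁆∣ {x = fzero} (inside ∷ C) x∉C = ⊥-elim (x∉C here)
∣∪⁅⁆∣ {x = fzero} (outside ∷ C) _ rewrite ∪-identityʳ C = refl
∣∪⁅⁆∣ {x = fsuc x} (inside ∷ C) x∉C rewrite ∣∪⁅⁆∣ C (x∉C ∘ there) = refl
∣∪⁅⁆∣ {x = fsuc x} (outside ∷ C) x∉C = ∣∪⁅⁆∣ C (x∉C ∘ there)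

weight-∪⁅⁆ : ∀ {m} {x : Fin m} (C : Subset m) → x ∉ C → weight (C ∪ ⁅ x ⁆) ≡ suc (toℕ x) + weight C
weight-∪⁅⁆ {x = fzero} (inside ∷ C) x∉C = ⊥-elim (x∉C here)
weight-∪⁅⁆ {x = fzero} (outside ∷ C) _ rewrite ∪-identityʳ C = refl
weight-∪⁅⁆ {x = fsuc x} (s ∷ C) x∉C = begin
  ∣ (s ∷ C) ∪ ⁅ fsuc x ⁆ ∣ + weight (C ∪ ⁅ x ⁆)
    ≡⟨ cong₂ _+_ (∣∪⁅⁆∣ (s ∷ C) x∉C) (weight-∪⁅⁆ C (x∉C ∘ there)) ⟩
  suc ∣ s ∷ C ∣ + (suc (toℕ x) + weight C)
    ≡⟨ shift ∣ s ∷ C ∣ (toℕ x) (weight C) ⟩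
  suc (suc (toℕ x)) + (∣ s ∷ C ∣ + weight C) ∎
  where
  open ≡-Reasoning
  shift : ∀ c x w → suc c + (suc x + w) ≡ suc (suc x) + (c + w)
  shift = solve-∀

x∈p-y⇒x≢y : ∀ {m} {x y : Fin m} (p : Subset m) → x ∈ p - y → x ≢ y
x∈p-y⇒x≢y {x = fzero} {fzero} (_ ∷ _) ()
x∈p-y⇒x≢y {x = fsuc x} {fsuc y} (_ ∷ p) (there x∈p-y) refl = x∈p-y⇒x≢y p x∈p-y refl

x∈p-y⁻ : ∀ {m} {x y : Fin m} (p : Subset m) → x ∈ p - y → x ∈ p × x ≢ y
x∈p-y⁻ {y = y} p x∈p-y = p─q⊆p p ⁅ y ⁆ x∈p-y , x∈p-y⇒x≢y p x∈p-y

allSubset? : ∀ {m} {P : Subset m → Set} → Decidable P → Dec (∀ S → P S)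
allSubset? P? with anySubset? (¬? ∘ P?)
... | yes (S , ¬PS) = no λ ∀P → ¬PS (∀P S)
... | no ¬∃¬P = yes λ S → decidable-stable (P? S) λ ¬PS → ¬∃¬P (S , ¬PS)

∖≐? : ∀ {m} (S T : Subset m) u → Dec (S ∖ T ≐ u)
∖≐? S T u = u ∈? S ×-dec ¬? (u ∈? T) ×-dec all? λ w → w ∈? S →-dec (¬? (w ∈? T) →-dec (w ≟ u))

module _ {m : ℕ} {S T : Subset m} where

  ∖≐-∈ : ∀ {v w} → S ∖ T ≐ v → w ∈ S → w ≢ v → w ∈ T
  ∖≐-∈ {w = w} (_ , _ , only-v) w∈S w≢v with w ∈? T
  ... | yes w∈T = w∈T
  ... | no w∉T = ⊥-elim (w≢v (only-v w w∈S w∉T))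

  ∖≐-∉ : ∀ {u w} → S ∖ T ≐ u → w ∉ T → w ≢ u → w ∉ S
  ∖≐-∉ (_ , _ , only-u) w∉T w≢u w∈S = w≢u (only-u _ w∈S w∉T)

  ∖≐⇒≡∩∪⁅⁆ : ∀ {u} → S ∖ T ≐ u → S ≡ (S ∩ T) ∪ ⁅ u ⁆
  ∖≐⇒≡∩∪⁅⁆ {u} (u∈S , _ , only-u) = ⊆-antisym split merge
    where
    split : S ⊆ (S ∩ T) ∪ ⁅ u ⁆
    split {w} w∈S with w ∈? T
    ... | yes w∈T = x∈p∪q⁺ (inj₁ (x∈p∩q⁺ (w∈S , w∈T)))
    ... | no w∉T rewrite only-u w w∈S w∉T = x∈p∪q⁺ (inj₂ (x∈⁅x⁆ u))
    merge : (S ∩ T) ∪ ⁅ u ⁆ ⊆ S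
    merge w∈ with x∈p∪q⁻ (S ∩ T) ⁅ u ⁆ w∈
    ... | inj₁ w∈S∩T = proj₁ (x∈p∩q⁻ S T w∈S∩T)
    ... | inj₂ w∈⁅u⁆ rewrite x∈⁅y⁆⇒x≡y u w∈⁅u⁆ = u∈S

  ∖≐⇒∉∩ : ∀ {u} → S ∖ T ≐ u → u ∉ S ∩ T
  ∖≐⇒∉∩ (_ , u∉T , _) u∈S∩T = u∉T (proj₂ (x∈p∩q⁻ S T u∈S∩T))

  ∖≐-∣∣ : ∀ {u} → S ∖ T ≐ u → ∣ S ∣ ≡ suc ∣ S ∩ T ∣
  ∖≐-∣∣ S∖T≐u = trans (cong ∣_∣ (∖≐⇒≡∩∪⁅⁆ S∖T≐u)) (∣∪⁅⁆∣ (S ∩ T) (∖≐⇒∉∩ S∖T≐u))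

  ∖≐-weight : ∀ {u} → S ∖ T ≐ u → weight S ≡ suc (toℕ u) + weight (S ∩ T)
  ∖≐-weight S∖T≐u = trans (cong weight (∖≐⇒≡∩∪⁅⁆ S∖T≐u)) (weight-∪⁅⁆ (S ∩ T) (∖≐⇒∉∩ S∖T≐u))

module _ {m : ℕ} {S T : Subset m} {u v : Fin m} (S∖T≐u : S ∖ T ≐ u) (T∖S≐v : T ∖ S ≐ v) where

  exchange-∣∣ : ∣ S ∣ ≡ ∣ T ∣
  exchange-∣∣ = begin
    ∣ S ∣          ≡⟨ ∖≐-∣∣ S∖T≐u ⟩
    suc ∣ S ∩ T ∣  ≡⟨ cong (suc ∘ ∣_∣) (∩-comm S T) ⟩
    suc ∣ T ∩ S ∣  ≡⟨ sym (∖≐-∣∣ T∖S≐v) ⟩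
    ∣ T ∣          ∎
    where open ≡-Reasoning

  exchange-weight : toℕ u < toℕ v → weight S < weight T
  exchange-weight u<v = begin-strict
    weight S                      ≡⟨ ∖≐-weight S∖T≐u ⟩
    suc (toℕ u) + weight (S ∩ T)  <⟨ +-monoˡ-< (weight (S ∩ T)) (s<s u<v) ⟩
    suc (toℕ v) + weight (S ∩ T)  ≡⟨ cong (λ C → suc (toℕ v) + weight C) (∩-comm S T) ⟩
    suc (toℕ v) + weight (T ∩ S)  ≡⟨ sym (∖≐-weight T∖S≐v) ⟩
    weight T                      ∎
    where open ≤-Reasoning

module _ {m : ℕ} {J J₁ J₂ : Subset m} {u₁ v : Fin m}
         (J₁∖J≐u₁ : J₁ ∖ J ≐ u₁) (J∖J₁≐v : J ∖ J₁ ≐ v) (J∖J₂≐v : J ∖ J₂ ≐ v) where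

  same-removed : ∀ w → w ∈ J₁ → w ∉ J₂ → w ≡ u₁
  same-removed w w∈J₁ w∉J₂ with w ∈? J
  ... | no w∉J = proj₂ (proj₂ J₁∖J≐u₁) w w∈J₁ w∉J
  ... | yes w∈J rewrite proj₂ (proj₂ J∖J₂≐v) w w∈J w∉J₂ = ⊥-elim (proj₁ (proj₂ J∖J₁≐v) w∈J₁)

  same-removed-⊆ : u₁ ∈ J₂ → J₁ ⊆ J₂
  same-removed-⊆ u₁∈J₂ {w} w∈J₁ with w ∈? J₂
  ... | yes w∈J₂ = w∈J₂
  ... | no w∉J₂ rewrite same-removed w w∈J₁ w∉J₂ = u₁∈J₂

  same-removed-∖≐ : u₁ ∉ J₂ → J₁ ∖ J₂ ≐ u₁
  same-removed-∖≐ u₁∉J₂ = proj₁ J₁∖J≐u₁ , u₁∉J₂ , same-removed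

module _ {m : ℕ} {J J₁ J₂ : Subset m} {u₁ v₁ u₂ v₂ : Fin m}
         (J₁∖J≐u₁ : J₁ ∖ J ≐ u₁) (J∖J₁≐v₁ : J ∖ J₁ ≐ v₁)
         (J₂∖J≐u₂ : J₂ ∖ J ≐ u₂) (J∖J₂≐v₂ : J ∖ J₂ ≐ v₂) (v₁≢v₂ : v₁ ≢ v₂) where

  cross-removed : ∀ {w} → w ∈ J₁ - v₂ → w ∉ J₂ - v₁ → w ≡ u₁
  cross-removed {w} w∈J₁-v₂ w∉J₂-v₁ with x∈p-y⁻ J₁ w∈J₁-v₂ | w ∈? J
  ... | w∈J₁ , _ | no w∉J = proj₂ (proj₂ J₁∖J≐u₁) w w∈J₁ w∉J
  ... | w∈J₁ , w≢v₂ | yes w∈J =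
    ⊥-elim (w∉J₂-v₁ (x∈p∧x≢y⇒x∈p-y (∖≐-∈ J∖J₂≐v₂ w∈J w≢v₂) λ { refl → proj₁ (proj₂ J∖J₁≐v₁) w∈J₁ }))

  diamond : u₁ ≢ u₂ → (J₁ - v₂) ∪ (J₂ - v₁) ∖ J₁ ≐ u₂ × J₁ ∖ (J₁ - v₂) ∪ (J₂ - v₁) ≐ v₂
  diamond u₁≢u₂ = (u₂∈K , u₂∉J₁ , only-u₂) , (v₂∈J₁ , v₂∉K , only-v₂)
    where
    K = (J₁ - v₂) ∪ (J₂ - v₁)
    u₂∉J = proj₁ (proj₂ J₂∖J≐u₂)
    u₂∈K : u₂ ∈ K
    u₂∈K = x∈p∪q⁺ (inj₂ (x∈p∧x≢y⇒x∈p-y (proj₁ J₂∖J≐u₂) λ { refl → u₂∉J (proj₁ J∖J₁≐v₁) }))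
    u₂∉J₁ : u₂ ∉ J₁
    u₂∉J₁ = ∖≐-∉ J₁∖J≐u₁ u₂∉J (u₁≢u₂ ∘ sym)
    only-u₂ : ∀ w → w ∈ K → w ∉ J₁ → w ≡ u₂
    only-u₂ w w∈K w∉J₁ with x∈p∪q⁻ (J₁ - v₂) (J₂ - v₁) w∈K
    ... | inj₁ w∈J₁-v₂ = ⊥-elim (w∉J₁ (p─q⊆p J₁ ⁅ v₂ ⁆ w∈J₁-v₂))
    ... | inj₂ w∈J₂-v₁ with x∈p-y⁻ J₂ w∈J₂-v₁ | w ∈? J
    ...   | _ , w≢v₁ | yes w∈J = ⊥-elim (w≢v₁ (proj₂ (proj₂ J∖J₁≐v₁) w w∈J w∉J₁))
    ...   | w∈J₂ , _ | no w∉J = proj₂ (proj₂ J₂∖J≐u₂) w w∈J₂ w∉J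
    v₂∈J₁ : v₂ ∈ J₁
    v₂∈J₁ = ∖≐-∈ J∖J₁≐v₁ (proj₁ J∖J₂≐v₂) (v₁≢v₂ ∘ sym)
    v₂∉K : v₂ ∉ K
    v₂∉K v₂∈K with x∈p∪q⁻ (J₁ - v₂) (J₂ - v₁) v₂∈K
    ... | inj₁ v₂∈J₁-v₂ = x∈p-y⇒x≢y J₁ v₂∈J₁-v₂ refl
    ... | inj₂ v₂∈J₂-v₁ = proj₁ (proj₂ J∖J₂≐v₂) (p─q⊆p J₂ ⁅ v₁ ⁆ v₂∈J₂-v₁)
    only-v₂ : ∀ w → w ∈ J₁ → w ∉ K → w ≡ v₂
    only-v₂ w w∈J₁ w∉K with w ≟ v₂
    ... | yes w≡v₂ = w≡v₂
    ... | no w≢v₂ = ⊥-elim (w∉K (x∈p∪q⁺ (inj₁ (x∈p∧x≢y⇒x∈p-y w∈J₁ w≢v₂))))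

-- Piles

module _ {X : Set} where

  Below : X → X → List X → Set
  Below u v p = Σ (List X) λ xs → Σ (List X) λ ys → Σ (List X) λ zs → p ≡ xs ++ (v ∷ ys ++ (u ∷ zs))

  -- shaped so that PlacedBelow a u v is definitionally OnLaterPile (Below u v) (piles a)
  OnLaterPile : (List X → Set) → List (List X) → Set
  OnLaterPile P L =
    Σ ℕ λ i → 1 ≤ i × Σ (List X) λ p → Σ (List (List X)) λ rest → drop i L ≡ p ∷ rest × P p

  Below-∈ᵘ : ∀ {u v p} → Below u v p → u ∈ₗ p
  Below-∈ᵘ (xs , ys , _ , refl) = ∈-++⁺ʳ xs (there (∈-++⁺ʳ ys (here refl)))

  Below-∈ᵛ : ∀ {u v p} → Below u v p → v ∈ₗ p
  Below-∈ᵛ (xs , _ , _ , refl) = ∈-++⁺ʳ xs (here refl)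

  AllPairs-Below : ∀ {ℓ} {R : Rel X ℓ} {u v p} → AllPairs R p → Below u v p → R v u
  AllPairs-Below (v↝ ∷ _) ([] , ys , _ , refl) = All.lookup v↝ (∈-++⁺ʳ ys (here refl))
  AllPairs-Below (_ ∷ R-p) (_ ∷ xs , ys , zs , refl) = AllPairs-Below R-p (xs , ys , zs , refl)

  Below-total : ∀ {x y p} → x ∈ₗ p → y ∈ₗ p → x ≢ y → Below y x p ⊎ Below x y p
  Below-total (here refl) (here refl) x≢y = ⊥-elim (x≢y refl)
  Below-total (here refl) (there y∈p) _ with ys , zs , refl ← ∈-∃++ y∈p = inj₁ ([] , ys , zs , refl)
  Below-total (there x∈p) (here refl) _ with ys , zs , refl ← ∈-∃++ x∈p = inj₂ ([] , ys , zs , refl)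
  Below-total {p = z ∷ _} (there x∈p) (there y∈p) x≢y with Below-total x∈p y∈p x≢y
  ... | inj₁ (xs , ys , zs , refl) = inj₁ (z ∷ xs , ys , zs , refl)
  ... | inj₂ (xs , ys , zs , refl) = inj₂ (z ∷ xs , ys , zs , refl)

  drop-∈ : ∀ {L : List (List X)} i {p rest} → drop i L ≡ p ∷ rest → p ∈ₗ L
  drop-∈ {_ ∷ _} zero refl = here refl
  drop-∈ {_ ∷ L} (suc i) eq = there (drop-∈ i eq)

  drop-disjoint : ∀ {L : List (List X)} → AllPairs Disjoint L → ∀ i j {p q r s x} →
    drop i L ≡ p ∷ r → drop j L ≡ q ∷ s → x ∈ₗ p → x ∈ₗ q → i ≡ j
  drop-disjoint {_ ∷ _} _ zero zero _ _ _ _ = refl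
  drop-disjoint {_ ∷ _} (p# ∷ _) zero (suc j) refl eq x∈p x∈q =
    ⊥-elim (All.lookup p# (drop-∈ j eq) (x∈p , x∈q))
  drop-disjoint {_ ∷ _} (q# ∷ _) (suc i) zero eq refl x∈p x∈q =
    ⊥-elim (All.lookup q# (drop-∈ i eq) (x∈q , x∈p))
  drop-disjoint {_ ∷ _} (_ ∷ L#) (suc i) (suc j) eq eq′ x∈p x∈q =
    cong suc (drop-disjoint L# i j eq eq′ x∈p x∈q)

  module _ {L : List (List X)} where

    OnLaterPile-Below⇒ : ∀ {ℓ} {R : Rel X ℓ} {u v} →
      All (AllPairs R) L → OnLaterPile (Below u v) L → R v u
    OnLaterPile-Below⇒ R-L (i , _ , _ , _ , eq , u<v) = AllPairs-Below (All.lookup R-L (drop-∈ i eq)) u<v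

    OnLaterPile-Below-total : AllPairs Disjoint L → ∀ {u u′ v} →
      OnLaterPile (Below u v) L → OnLaterPile (Below u′ v) L → u ≢ u′ →
      OnLaterPile (Below u u′) L ⊎ OnLaterPile (Below u′ u) L
    OnLaterPile-Below-total L# (i , 1≤i , p , rest , eq , u<v) (j , _ , q , _ , eq′ , u′<v) u≢u′
      with drop-disjoint L# i j eq eq′ (Below-∈ᵛ u<v) (Below-∈ᵛ u′<v)
    ... | refl with ∷-injectiveˡ (trans (sym eq) eq′)
    ... | refl with Below-total (Below-∈ᵘ u<v) (Below-∈ᵘ u′<v) u≢u′
    ...   | inj₁ u′<u = inj₂ (i , 1≤i , p , rest , eq , u′<u)
    ...   | inj₂ u<u′ = inj₁ (i , 1≤i , p , rest , eq , u<u′)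

  Disjoint-∷ˡ : ∀ {x : X} {p q} → x ∉ₗ q → Disjoint p q → Disjoint (x ∷ p) q
  Disjoint-∷ˡ x∉q p#q (here refl , x∈q) = x∉q x∈q
  Disjoint-∷ˡ x∉q p#q (there v∈p , v∈q) = p#q (v∈p , v∈q)

  module _ (_≟ₓ_ : DecidableEquality X) where
    open DecMembership _≟ₓ_ using () renaming (_∈?_ to _∈ₗ?_)

    below? : ∀ u v → Decidable (Below u v)
    below? u v [] = no λ { ([] , _ , _ , ()) ; (_ ∷ _ , _ , _ , ()) }
    below? u v (z ∷ p) = map′ to from ((z ≟ₓ v ×-dec u ∈ₗ? p) ⊎-dec below? u v p)
      where
      to : (z ≡ v × u ∈ₗ p) ⊎ Below u v p → Below u v (z ∷ p)
      to (inj₁ (refl , u∈p)) with ys , zs , refl ← ∈-∃++ u∈p = [] , ys , zs , refl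
      to (inj₂ (xs , ys , zs , refl)) = z ∷ xs , ys , zs , refl
      from : Below u v (z ∷ p) → (z ≡ v × u ∈ₗ p) ⊎ Below u v p
      from ([] , ys , zs , refl) = inj₁ (refl , ∈-++⁺ʳ ys (here refl))
      from (_ ∷ xs , ys , zs , eq) = inj₂ (xs , ys , zs , proj₂ (∷-injective eq))

  OnPile : (List X → Set) → List (List X) → Set
  OnPile P L = Σ ℕ λ i → Σ (List X) λ p → Σ (List (List X)) λ rest → drop i L ≡ p ∷ rest × P p

  onPile? : ∀ {P} → Decidable P → Decidable (OnPile P)
  onPile? P? [] = no λ { (zero , _ , _ , () , _) ; (suc _ , _ , _ , () , _) }
  onPile? {P} P? (q ∷ L) = map′ to from (P? q ⊎-dec onPile? P? L)
    where
    to : P q ⊎ OnPile P L → OnPile P (q ∷ L)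
    to (inj₁ Pq) = 0 , q , L , refl , Pq
    to (inj₂ (i , p , rest , eq , Pp)) = suc i , p , rest , eq , Pp
    from : OnPile P (q ∷ L) → P q ⊎ OnPile P L
    from (zero , _ , _ , refl , Pq) = inj₁ Pq
    from (suc i , p , rest , eq , Pp) = inj₂ (i , p , rest , eq , Pp)

  onLaterPile? : ∀ {P} → Decidable P → Decidable (OnLaterPile P)
  onLaterPile? P? [] = no λ { (zero , () , _) ; (suc _ , _ , _ , _ , () , _) }
  onLaterPile? {P} P? (_ ∷ L) = map′ to from (onPile? P? L)
    where
    to : OnPile P L → OnLaterPile P (_ ∷ L)
    to (i , rest) = suc i , s≤s z≤n , rest
    from : OnLaterPile P (_ ∷ L) → OnPile P L
    from (suc i , _ , rest) = i , rest

-- Patience sorting and the exchange relation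

module _ {n : ℕ} (a : Fin n → Fin n) where

  Inversion : Idx a → Idx a → Set
  Inversion i j = toℕ i < toℕ j × A a j < A a i

  Increasing : Idx a → Idx a → Set
  Increasing i j = toℕ i < toℕ j → A a i < A a j

  Compatible : Idx a → Idx a → Set
  Compatible i j = Increasing i j × Increasing j i

  ordered⇒Compatible : ∀ {i j} → toℕ i < toℕ j → A a i < A a j → Compatible i j
  ordered⇒Compatible i<j Ai<Aj = (λ _ → Ai<Aj) , λ j<i → ⊥-elim (<-asym i<j j<i)

  Feasible⇒Compatible : ∀ {S i j} → Feasible a S → i ∈ S → j ∈ S → Compatible i j
  Feasible⇒Compatible F i∈S j∈S = F _ _ i∈S j∈S , F _ _ j∈S i∈S

  Feasible⇒¬Inversion : ∀ {S i j} → Feasible a S → i ∈ S → j ∈ S → ¬ Inversion i j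
  Feasible⇒¬Inversion F i∈S j∈S (i<j , Aj<Ai) = <-asym Aj<Ai (F _ _ i∈S j∈S i<j)

  Feasible-⊆ : ∀ {S T} → S ⊆ T → Feasible a T → Feasible a S
  Feasible-⊆ S⊆T F i j i∈S j∈S = F i j (S⊆T i∈S) (S⊆T j∈S)

  Feasible-∪ : ∀ {S T} → Feasible a S → Feasible a T →
    (∀ {x y} → x ∈ S → x ∉ T → y ∈ T → y ∉ S → Compatible x y) → Feasible a (S ∪ T)
  Feasible-∪ {S} {T} FS FT cross i j i∈ j∈ with x∈p∪q⁻ S T i∈ | x∈p∪q⁻ S T j∈
  ... | inj₁ i∈S | inj₁ j∈S = FS i j i∈S j∈S
  ... | inj₂ i∈T | inj₂ j∈T = FT i j i∈T j∈T
  ... | inj₁ i∈S | inj₂ j∈T with j ∈? S | i ∈? T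
  ...   | yes j∈S | _ = FS i j i∈S j∈S
  ...   | no _ | yes i∈T = FT i j i∈T j∈T
  ...   | no j∉S | no i∉T = proj₁ (cross i∈S i∉T j∈T j∉S)
  Feasible-∪ {S} {T} FS FT cross i j i∈ j∈ | inj₂ i∈T | inj₁ j∈S with i ∈? S | j ∈? T
  ...   | yes i∈S | _ = FS i j i∈S j∈S
  ...   | no _ | yes j∈T = FT i j i∈T j∈T
  ...   | no i∉S | no j∉T = proj₂ (cross j∈S j∉T i∈T i∉S)

  MaxFeasible-exchange : ∀ {S T u v} → MaxFeasible a T → Feasible a S → S ∖ T ≐ u → T ∖ S ≐ v →
    MaxFeasible a S
  MaxFeasible-exchange (_ , T-max) FS S∖T≐u T∖S≐v =
    FS , λ J FJ → ≤-trans (T-max J FJ) (≤-reflexive (sym (exchange-∣∣ S∖T≐u T∖S≐v)))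

  Bounded : ℕ → List (Idx a) → Set
  Bounded b = All (λ y → toℕ y < b)

  Bounded⇒∉ : ∀ {x p} → Bounded (toℕ x) p → x ∉ₗ p
  Bounded⇒∉ bnd x∈p = <-irrefl refl (All.lookup bnd x∈p)

  place-All : ∀ {P Q : List (Idx a) → Set} {x} ps → All Q ps → All P ps → P (x ∷ []) →
    (∀ {t p} → A a x < A a t → Q (t ∷ p) → P (t ∷ p) → P (x ∷ t ∷ p)) → All P (place a x ps)
  place-All [] _ _ P[x] _ = P[x] ∷ []
  place-All ([] ∷ _) (_ ∷ _) (_ ∷ P-ps) P[x] _ = P[x] ∷ P-ps
  place-All {x = x} ((t ∷ p) ∷ ps) (Qtp ∷ Q-ps) (Ptp ∷ P-ps) P[x] push with A a x <ᵇ A a t in x<ᵇt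
  ... | true = push (<ᵇ⇒< _ _ (Equivalence.from T-≡ x<ᵇt)) Qtp Ptp ∷ P-ps
  ... | false = Ptp ∷ place-All ps Q-ps P-ps P[x] push

  record Invariant (b : ℕ) (ps : Piles a) : Set where
    field
      bounded : All (Bounded b) ps
      descending : All (AllPairs (flip Inversion)) ps
      disjoint : AllPairs Disjoint ps

  place-Invariant : ∀ {b ps x} → b ≤ toℕ x → Invariant b ps → Invariant (suc (toℕ x)) (place a x ps)
  place-Invariant {b} {ps} {x} b≤x inv = record
    { bounded = place-All ps below-x (All.map (All.map m≤n⇒m≤1+n) below-x) (n<1+n _ ∷ [])
                  λ _ _ bnd → n<1+n _ ∷ bnd
    ; descending = place-All ps below-x (Invariant.descending inv) ([] ∷ []) push-descending
    ; disjoint = place-disjoint ps below-x (Invariant.disjoint inv)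
    }
    where
    below-x : All (Bounded (toℕ x)) ps
    below-x = All.map (All.map λ y<b → <-≤-trans y<b b≤x) (Invariant.bounded inv)

    push-descending : ∀ {t p} → A a x < A a t → Bounded (toℕ x) (t ∷ p) →
      AllPairs (flip Inversion) (t ∷ p) → AllPairs (flip Inversion) (x ∷ t ∷ p)
    push-descending x<t (t<x ∷ p<x) (t↝p ∷ desc) =
      ((t<x , x<t) ∷ All.zipWith (λ (y<x , (_ , t<y)) → y<x , <-trans x<t t<y) (p<x , t↝p)) ∷ t↝p ∷ desc

    push-fresh : ∀ {p qs} → All (Bounded (toℕ x)) qs → All (Disjoint p) qs → All (Disjoint (x ∷ p)) qs
    push-fresh [] [] = []
    push-fresh (q<x ∷ bnd) (p#q ∷ p#qs) = Disjoint-∷ˡ (Bounded⇒∉ q<x) p#q ∷ push-fresh bnd p#qs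

    place-disjoint : ∀ ps → All (Bounded (toℕ x)) ps → AllPairs Disjoint ps →
      AllPairs Disjoint (place a x ps)
    place-disjoint [] _ _ = [] ∷ []
    place-disjoint ([] ∷ ps) (_ ∷ bnd) (_ ∷ ps#) =
      push-fresh bnd (All.universal (λ _ → λ { (() , _) }) ps) ∷ ps#
    place-disjoint ((t ∷ p) ∷ ps) (tp<x ∷ bnd) (tp# ∷ ps#) with A a x <ᵇ A a t
    ... | true = push-fresh bnd tp# ∷ ps#
    ... | false =
      place-All ps bnd tp# (fresh λ { (_ , ()) }) (λ _ _ → fresh) ∷ place-disjoint ps bnd ps#
      where
      fresh : ∀ {q} → Disjoint (t ∷ p) q → Disjoint (t ∷ p) (x ∷ q)
      fresh tp#q = Disjoint-sym (Disjoint-∷ˡ (Bounded⇒∉ tp<x) (Disjoint-sym tp#q))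

  foldl-Invariant : ∀ {b ps} xs → All (λ x → b ≤ toℕ x) xs → AllPairs (λ x y → toℕ x < toℕ y) xs →
    Invariant b ps → ∃ λ b′ → Invariant b′ (foldl (λ ps x → place a x ps) ps xs)
  foldl-Invariant [] _ _ inv = _ , inv
  foldl-Invariant (x ∷ xs) (b≤x ∷ _) (x<xs ∷ sorted) inv =
    foldl-Invariant xs x<xs sorted (place-Invariant b≤x inv)

  piles-Invariant : ∃ λ b → Invariant b (piles a)
  piles-Invariant = foldl-Invariant (allFin _) (tabulate⁺ {f = id} λ _ → z≤n) (tabulate⁺-< {f = id} id)
    (record { bounded = [] ; descending = [] ; disjoint = [] })

  PlacedBelow⇒Inversion : ∀ {u v} → PlacedBelow a u v → Inversion u v
  PlacedBelow⇒Inversion = OnLaterPile-Below⇒ (Invariant.descending (proj₂ piles-Invariant))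

  PlacedBelow-total : ∀ {u u′ v} → PlacedBelow a u v → PlacedBelow a u′ v → u ≢ u′ →
    PlacedBelow a u u′ ⊎ PlacedBelow a u′ u
  PlacedBelow-total = OnLaterPile-Below-total (Invariant.disjoint (proj₂ piles-Invariant))

  placedBelow? : ∀ u v → Dec (PlacedBelow a u v)
  placedBelow? u v = onLaterPile? (below? _≟_ u v) (piles a)

  crossing : ∀ {u₁ v₁ u₂ v₂} → Inversion u₁ v₁ → Inversion u₂ v₂ → toℕ v₁ < toℕ v₂ → A a v₁ < A a v₂ →
    Increasing u₁ v₂ → Increasing u₂ v₁ → Compatible u₁ u₂
  crossing {u₁} {v₁} {u₂} (u₁<v₁ , _) (_ , Av₂<Au₂) v₁<v₂ Av₁<Av₂ u₁↗v₂ u₂↗v₁ =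
    ordered⇒Compatible u₁<u₂ Au₁<Au₂
    where
    Au₁<Au₂ : A a u₁ < A a u₂
    Au₁<Au₂ = <-trans (u₁↗v₂ (<-trans u₁<v₁ v₁<v₂)) Av₂<Au₂
    u₁<u₂ : toℕ u₁ < toℕ u₂
    u₁<u₂ with toℕ u₁ <? toℕ u₂
    ... | yes u₁<u₂ = u₁<u₂
    ... | no u₁≮u₂ =
      ⊥-elim (<-irrefl refl (<-trans (u₂↗v₁ (≤-<-trans (≮⇒≥ u₁≮u₂) u₁<v₁)) (<-trans Av₁<Av₂ Av₂<Au₂)))

  crossing-Compatible : ∀ {u₁ v₁ u₂ v₂} → PlacedBelow a u₁ v₁ → PlacedBelow a u₂ v₂ → v₁ ≢ v₂ →
    Compatible v₁ v₂ → Compatible u₁ v₂ → Compatible u₂ v₁ → Compatible u₁ u₂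
  crossing-Compatible {v₁ = v₁} {v₂ = v₂} u₁<v₁ u₂<v₂ v₁≢v₂ v₁~v₂ u₁~v₂ u₂~v₁ with <-cmp-Fin v₁ v₂
  ... | tri< v₁<v₂ _ _ =
    crossing (PlacedBelow⇒Inversion u₁<v₁) (PlacedBelow⇒Inversion u₂<v₂) v₁<v₂ (proj₁ v₁~v₂ v₁<v₂)
      (proj₁ u₁~v₂) (proj₁ u₂~v₁)
  ... | tri≈ _ v₁≡v₂ _ = ⊥-elim (v₁≢v₂ v₁≡v₂)
  ... | tri> _ _ v₂<v₁ =
    swap (crossing (PlacedBelow⇒Inversion u₂<v₂) (PlacedBelow⇒Inversion u₁<v₁) v₂<v₁ (proj₂ v₁~v₂ v₂<v₁)
      (proj₁ u₂~v₁) (proj₁ u₁~v₂))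

  infix 4 _◁[_,_]_

  _◁[_,_]_ : Subset (suc n) → Idx a → Idx a → Subset (suc n) → Set
  J′ ◁[ u , v ] J = MaxFeasible a J′ × MaxFeasible a J × J′ ∖ J ≐ u × J ∖ J′ ≐ v × PlacedBelow a u v

  ◁[]⇒◁ : ∀ {J′ J u v} → J′ ◁[ u , v ] J → _◁_ a J′ J
  ◁[]⇒◁ {u = u} {v} (mf′ , mf , exchange) = mf′ , mf , u , v , exchange

  same-exchange : ∀ {J J₁ J₂ u v} → J₁ ◁[ u , v ] J → J₂ ◁[ u , v ] J → J₁ ≡ J₂
  same-exchange (_ , _ , J₁∖J≐u , J∖J₁≐v , _) (_ , _ , J₂∖J≐u , J∖J₂≐v , _) =
    ⊆-antisym (same-removed-⊆ J₁∖J≐u J∖J₁≐v J∖J₂≐v (proj₁ J₂∖J≐u))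
              (same-removed-⊆ J₂∖J≐u J∖J₂≐v J∖J₁≐v (proj₁ J₁∖J≐u))

  same-added : ∀ {J J₁ J₂ u v₁ v₂} → J₁ ◁[ u , v₁ ] J → J₂ ◁[ u , v₂ ] J → v₁ ≡ v₂
  same-added {v₁ = v₁} {v₂} ((F₁ , _) , _ , J₁∖J≐u , J∖J₁≐v₁ , _) (_ , _ , _ , J∖J₂≐v₂ , u<v₂)
    with v₁ ≟ v₂
  ... | yes v₁≡v₂ = v₁≡v₂
  ... | no v₁≢v₂ = ⊥-elim (Feasible⇒¬Inversion F₁ (proj₁ J₁∖J≐u)
                             (∖≐-∈ J∖J₁≐v₁ (proj₁ J∖J₂≐v₂) (v₁≢v₂ ∘ sym)) (PlacedBelow⇒Inversion u<v₂))

  same-removed-◁ : ∀ {J J₁ J₂ u₁ u₂ v} → J₁ ◁[ u₁ , v ] J → J₂ ◁[ u₂ , v ] J → u₁ ≢ u₂ →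
    PlacedBelow a u₁ u₂ → J₁ ◁[ u₁ , u₂ ] J₂
  same-removed-◁ (mf₁ , _ , J₁∖J≐u₁ , J∖J₁≐v , _) (mf₂ , _ , J₂∖J≐u₂ , J∖J₂≐v , _) u₁≢u₂ u₁<u₂ =
    mf₁ , mf₂ ,
    same-removed-∖≐ J₁∖J≐u₁ J∖J₁≐v J∖J₂≐v (∖≐-∉ J₂∖J≐u₂ (proj₁ (proj₂ J₁∖J≐u₁)) u₁≢u₂) ,
    same-removed-∖≐ J₂∖J≐u₂ J∖J₂≐v J∖J₁≐v (∖≐-∉ J₁∖J≐u₁ (proj₁ (proj₂ J₂∖J≐u₂)) (u₁≢u₂ ∘ sym)) ,
    u₁<u₂

  diamond-◁ : ∀ {J J₁ J₂ u₁ u₂ v₁ v₂} → J₁ ◁[ u₁ , v₁ ] J → J₂ ◁[ u₂ , v₂ ] J → u₁ ≢ u₂ → v₁ ≢ v₂ →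
    (J₁ - v₂) ∪ (J₂ - v₁) ◁[ u₂ , v₂ ] J₁
  diamond-◁ {J} {J₁} {J₂} {u₁} {u₂} {v₁} {v₂}
    (mf₁ , mf , J₁∖J≐u₁ , J∖J₁≐v₁ , u₁<v₁) (mf₂ , _ , J₂∖J≐u₂ , J∖J₂≐v₂ , u₂<v₂) u₁≢u₂ v₁≢v₂ =
    MaxFeasible-exchange mf₁ FK K∖J₁≐u₂ J₁∖K≐v₂ , mf₁ , K∖J₁≐u₂ , J₁∖K≐v₂ , u₂<v₂
    where
    K∖J₁≐u₂ = proj₁ (diamond J₁∖J≐u₁ J∖J₁≐v₁ J₂∖J≐u₂ J∖J₂≐v₂ v₁≢v₂ u₁≢u₂)
    J₁∖K≐v₂ = proj₂ (diamond J₁∖J≐u₁ J∖J₁≐v₁ J₂∖J≐u₂ J∖J₂≐v₂ v₁≢v₂ u₁≢u₂)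
    u₁~u₂ : Compatible u₁ u₂
    u₁~u₂ = crossing-Compatible u₁<v₁ u₂<v₂ v₁≢v₂
      (Feasible⇒Compatible (proj₁ mf) (proj₁ J∖J₁≐v₁) (proj₁ J∖J₂≐v₂))
      (Feasible⇒Compatible (proj₁ mf₁) (proj₁ J₁∖J≐u₁) (∖≐-∈ J∖J₁≐v₁ (proj₁ J∖J₂≐v₂) (v₁≢v₂ ∘ sym)))
      (Feasible⇒Compatible (proj₁ mf₂) (proj₁ J₂∖J≐u₂) (∖≐-∈ J∖J₂≐v₂ (proj₁ J∖J₁≐v₁) v₁≢v₂))
    FK : Feasible a ((J₁ - v₂) ∪ (J₂ - v₁))
    FK = Feasible-∪ (Feasible-⊆ (p─q⊆p J₁ ⁅ v₂ ⁆) (proj₁ mf₁))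
                    (Feasible-⊆ (p─q⊆p J₂ ⁅ v₁ ⁆) (proj₁ mf₂))
      λ x∈ x∉ y∈ y∉ →
        subst₂ Compatible
          (sym (cross-removed J₁∖J≐u₁ J∖J₁≐v₁ J₂∖J≐u₂ J∖J₂≐v₂ v₁≢v₂ x∈ x∉))
          (sym (cross-removed J₂∖J≐u₂ J∖J₂≐v₂ J₁∖J≐u₁ J∖J₁≐v₁ (v₁≢v₂ ∘ sym) y∈ y∉))
          u₁~u₂

  ◁-confluent : WeaklyConfluent (flip (_◁_ a))
  ◁-confluent (mf₁ , mf , u₁ , v₁ , exchange₁) (mf₂ , mf′ , u₂ , v₂ , exchange₂) =
    confluent-at (mf₁ , mf , exchange₁) (mf₂ , mf′ , exchange₂)
    where
    confluent-at : ∀ {J J₁ J₂ u₁ u₂ v₁ v₂} → J₁ ◁[ u₁ , v₁ ] J → J₂ ◁[ u₂ , v₂ ] J →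
      ∃ λ K → Star (flip (_◁_ a)) J₁ K × Star (flip (_◁_ a)) J₂ K
    confluent-at {J₁ = J₁} {J₂} {u₁} {u₂} {v₁} {v₂}
      J₁◁J@(_ , _ , _ , _ , u₁<v₁) J₂◁J@(_ , _ , _ , _ , u₂<v₂) with u₁ ≟ u₂ | v₁ ≟ v₂
    ... | yes refl | _ with refl ← same-added J₁◁J J₂◁J with refl ← same-exchange J₁◁J J₂◁J = J₁ , ε , ε
    ... | no u₁≢u₂ | no v₁≢v₂ =
      (J₁ - v₂) ∪ (J₂ - v₁) ,
      ◁[]⇒◁ (diamond-◁ J₁◁J J₂◁J u₁≢u₂ v₁≢v₂) ◅ ε ,
      ◁[]⇒◁ (subst (_◁[ u₁ , v₁ ] J₂) (∪-comm (J₂ - v₁) (J₁ - v₂))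
                    (diamond-◁ J₂◁J J₁◁J (u₁≢u₂ ∘ sym) (v₁≢v₂ ∘ sym))) ◅ ε
    ... | no u₁≢u₂ | yes refl with PlacedBelow-total u₁<v₁ u₂<v₂ u₁≢u₂
    ...   | inj₁ u₁<u₂ = J₁ , ε , ◁[]⇒◁ (same-removed-◁ J₁◁J J₂◁J u₁≢u₂ u₁<u₂) ◅ ε
    ...   | inj₂ u₂<u₁ = J₂ , ◁[]⇒◁ (same-removed-◁ J₂◁J J₁◁J (u₁≢u₂ ∘ sym) u₂<u₁) ◅ ε , ε

  ◁-weight : ∀ {J′ J} → _◁_ a J′ J → weight J′ < weight J
  ◁-weight (_ , _ , _ , _ , J′∖J≐u , J∖J′≐v , u<v) =
    exchange-weight J′∖J≐u J∖J′≐v (proj₁ (PlacedBelow⇒Inversion u<v))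

  feasible? : ∀ S → Dec (Feasible a S)
  feasible? S = all? λ i → all? λ j → i ∈? S →-dec (j ∈? S →-dec (toℕ i <? toℕ j →-dec A a i <? A a j))

  maxFeasible? : ∀ S → Dec (MaxFeasible a S)
  maxFeasible? S = feasible? S ×-dec allSubset? λ T → feasible? T →-dec ∣ T ∣ ≤? ∣ S ∣

  ◁? : ∀ J′ J → Dec (_◁_ a J′ J)
  ◁? J′ J = maxFeasible? J′ ×-dec maxFeasible? J ×-dec any? λ u → any? λ v →
    ∖≐? J′ J u ×-dec ∖≐? J J′ v ×-dec placedBelow? u v

  ◁-sn : StronglyNormalizing (Plus (flip (_◁_ a)))
  ◁-sn = measure⇒sn weight ◁-weight

  ◁-wn : WeaklyNormalizing (flip (_◁_ a))
  ◁-wn = sn&dec⇒wn ◁-sn λ J → anySubset? λ J′ → ◁? J′ J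

  InM-MaxFeasible : ∀ {I J} → MaxFeasible a I → InM a I J → MaxFeasible a J
  InM-MaxFeasible mf ε = mf
  InM-MaxFeasible _ (J◁ ◅ _) = proj₁ J◁

  ◁-Minimal⇔IsNormalForm : ∀ {J} → MaxFeasible a J → ◁-Minimal a J ⇔ IsNormalForm (flip (_◁_ a)) J
  ◁-Minimal⇔IsNormalForm mf =
    mk⇔ (λ (_ , no-J′) (J′ , J′◁J) → no-J′ (J′ , proj₁ J′◁J , J′◁J))
        (λ nf → mf , λ (J′ , _ , J′◁J) → nf (J′ , J′◁J))

lemma2 : (n : ℕ) (a : Fin n → Fin n) → Injective _≡_ _≡_ a →
    (I : Subset (suc n)) → MaxFeasible a I →
    Σ (Subset (suc n)) λ J → (◁-Minimal a J × InM a I J) ×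
      (∀ J′ → ◁-Minimal a J′ → InM a I J′ → J′ ≡ J)
lemma2 n a _ I mf with ◁-wn a I
... | J , J-nf , I↠J = J , (Equivalence.from (◁-Minimal⇔IsNormalForm a mfJ) J-nf , J∈M) , unique
  where
  J∈M = reverse id I↠J
  mfJ = InM-MaxFeasible a mf J∈M
  unique : ∀ J′ → ◁-Minimal a J′ → InM a I J′ → J′ ≡ J
  unique J′ J′-min J′∈M =
    conf⇒unf (sn&wcr⇒cr (◁-sn a) (◁-confluent a))
      (Equivalence.to (◁-Minimal⇔IsNormalForm a (InM-MaxFeasible a mf J′∈M)) J′-min) J-nf
      (a—↠b&a—↠c⇒b↔c (reverse id J′∈M) I↠J)
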